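{- For every cycle $C_n$ on $n\ge3$ vertices (embedded in the plane), $\pi_{fl}(C_n)\le 5$.
   Context: A sequence $r_1\dots r_{2n}$ is a repetition if $r_i=r_{n+i}$ for all $i\le n$. In a plane graph $G$, a facial path is a path whose vertices and edges are consecutive on the boundary walk of some face of $G$. A vertex colouring is facial non-repetitive if no facial path on vertices $v_1,\dots,v_{2n}$ ($n\ge1$) has colour sequence that is a repetition. $\pi_{fl}(G)$ is the minimum $l$ such that for every assignment of lists $L(v)\subseteq\mathbb{Z}_+$ with $|L(v)|\ge l$ there is a facial non-repetitive colouring $\varphi$ with $\varphi(v)\in L(v)$ for every vertex $v$. -}

module Defs where

open import Data.Nat using (ℕ; zero; suc; _+_; _*_; _∸_; _≤_; _<_)
open import Data.Nat.DivMod using (_%_; m%n<n)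
open import Data.Fin using (Fin; toℕ; fromℕ<)
open import Data.Product using (Σ; _×_)
open import Data.Sum using (_⊎_)
open import Relation.Binary.PropositionalEquality using (_≡_)
open import Relation.Nullary using (¬_)
open import Function.Definitions using (Injective)

-- The cycle C_n has vertex set Fin n, vertex v_a adjacent to v_{a+1 mod n}.
-- Embedded in the plane, both faces have boundary walk v_0 v_1 … v_{n-1} v_0.
-- cyc i j = v_{(i + j) mod n}.
cyc : ∀ {n} → Fin n → ℕ → Fin n
cyc {suc m} i j = fromℕ< (m%n<n (toℕ i + j) (suc m))

-- Direction along the boundary walk: step 1 (forward) or step n-1 (backward,
-- i.e. -1 mod n).
Step : ℕ → ℕ → Set
Step n s = (s ≡ 1) ⊎ (s ≡ n ∸ 1)

IsRepetition : ℕ → (ℕ → ℕ) → Set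
IsRepetition k r = ∀ j → j < k → r j ≡ r (k + j)

-- Facial paths of C_n on 2k vertices are exactly the sequences
-- v_i, v_{i+s}, …, v_{i+(2k-1)s} (indices mod n) with s = ±1 and 2k ≤ n
-- (consecutive on the boundary walk and with distinct vertices).
FacialNonRepetitive : (n : ℕ) → (Fin n → ℕ) → Set
FacialNonRepetitive n φ =
  (i : Fin n) (s : ℕ) → Step n s → (k : ℕ) → 1 ≤ k → 2 * k ≤ n →
  ¬ IsRepetition k (λ j → φ (cyc i (j * s)))

AtLeast : ℕ → (ℕ → Set) → Set
AtLeast l S = Σ (Fin l → ℕ) λ f → Injective _≡_ _≡_ f × (∀ a → S (f a))

ListAssignment : (n l : ℕ) → (Fin n → ℕ → Set) → Set
ListAssignment n l L = ∀ v → (∀ x → L v x → 1 ≤ x) × AtLeast l (L v)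

PiFLAtMost : ℕ → ℕ → Set₁
PiFLAtMost n l = (L : Fin n → ℕ → Set) → ListAssignment n l L →
  Σ (Fin n → ℕ) λ φ → (∀ v → L v (φ v)) × FacialNonRepetitive n φ

-- A colouring of C_n is a word w = w₀ … w_{n-1} picked from the lists, and its facial paths are the
-- cyclic factors of w of length at most n read in either direction; a repetition read backwards is a
-- forward one starting 2k - 1 places earlier.  So it suffices to pick w with no cyclic square.
--
-- Counting in the style of Rosenfeld: let N(Ls) be the number of square-free words over lists of
-- at least 5 letters.  Of the 5 N(Ls) extensions of square-free words by a first letter, each
-- non-square-free one starts with a square u u and is determined by the square-free word left after
-- deleting the first u; carrying the invariant 2 Σⱼ N(drop j Ls) ≤ 3 N(Ls) this gives
-- N(L ∷ Ls) ≥ 3 N(Ls), so removing k lists divides N by at least 3^k.  A square-free word with a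
-- cyclic square of half-length k must wrap around, which leaves 2k - 1 starting points, and it is
-- determined by the start and by the n - k letters outside one half of the square, a square-free
-- prefix or suffix.  Hence at most Σ_k (2k - 1) N / 3^k < N square-free words are cyclically bad.

module Submission where

open import Defs

open import Data.Nat using (ℕ; zero; suc; _+_; _*_; _∸_; _<_; _≤_; _^_; z≤n; s≤s; NonZero; _≤?_; _<?_)
open import Data.Nat.DivMod using (_%_; m<n⇒m%n≡m; [m+n]%n≡m%n; [m+kn]%n≡m%n; %-distribˡ-+; m%n%n≡m%n; m%n<n)
open import Data.Nat.Properties
open import Data.List
  using (List; []; _∷_; _++_; [_]; length; map; take; drop; reverse; filter; cartesianProductWith; applyUpTo; tabulate)
open import Data.List.Properties
  using ( length-++; length-map; length-take; length-drop; length-reverse; length-applyUpTo; length-tabulate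
        ; ∷-injective; ∷-injectiveʳ; ++-assoc; ++-identityʳ; take++drop≡id; drop-drop
        ; reverse-++; reverse-involutive; reverse-injective; ≡-dec )
open import Data.List.Membership.Propositional using (_∈_; find)
open import Data.List.Membership.Propositional.Properties
  using ( ∈-∃++; ∈-++⁻; ∈-++⁺ˡ; ∈-++⁺ʳ; ∈-map⁺; ∈-cartesianProductWith⁺; ∈-cartesianProductWith⁻
        ; ∈-filter⁺; ∈-filter⁻; ∈-applyUpTo⁺; ∈-tabulate⁻ )
open import Data.List.Relation.Unary.Any using (here; there)
open import Data.List.Relation.Unary.All as All using (All; []; _∷_)
open import Data.List.Relation.Unary.AllPairs using ([]; _∷_)
open import Data.List.Relation.Unary.Unique.Propositional using (Unique)
import Data.List.Relation.Unary.Unique.Propositional.Properties as Unique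
open import Data.List.Relation.Binary.Pointwise as Pointwise using (Pointwise; []; _∷_; Pointwise-length)
open import Data.Product using (∃-syntax; _×_; _,_; proj₁; proj₂)
open import Data.Sum using (inj₁; inj₂)
open import Data.Unit using (⊤; tt)
open import Data.Empty using (⊥-elim)
open import Function using (_∘_)
open import Data.Fin as Fin using (Fin; toℕ)
open import Data.Fin.Properties using (toℕ-fromℕ<; toℕ<n)
open import Relation.Nullary using (¬_; Dec; yes; no; ¬?)
open import Relation.Nullary.Decidable using (_×-dec_; map′)
open import Relation.Binary.PropositionalEquality hiding ([_])
open import Data.Nat.Tactic.RingSolver using (solve-∀)
import Data.List.Relation.Unary.All.Properties as All
import Data.List.Relation.Unary.Any.Properties as Any

-- Junk value 0 past the end; every use below is in range.
at : List ℕ → ℕ → ℕ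
at []      _       = 0
at (x ∷ w) zero    = x
at (x ∷ w) (suc j) = at w j

at-take : ∀ m w j → j < m → at (take m w) j ≡ at w j
at-take (suc m) []      j       _       = refl
at-take (suc m) (x ∷ w) zero    _       = refl
at-take (suc m) (x ∷ w) (suc j) (s≤s p) = at-take m w j p

at-drop : ∀ m w j → at (drop m w) j ≡ at w (m + j)
at-drop zero    w       j = refl
at-drop (suc m) []      j = refl
at-drop (suc m) (x ∷ w) j = at-drop m w j

at-extensionality : ∀ u v → length u ≡ length v → (∀ j → j < length u → at u j ≡ at v j) → u ≡ v
at-extensionality []      []      _  _ = refl
at-extensionality (x ∷ u) (y ∷ v) eq h =
  cong₂ _∷_ (h 0 (s≤s z≤n)) (at-extensionality u v (suc-injective eq) (λ j p → h (suc j) (s≤s p)))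

+-right-comm : ∀ x y z → x + y + z ≡ x + z + y
+-right-comm x y z = trans (+-assoc x y z) (trans (cong (x +_) (+-comm y z)) (sym (+-assoc x z y)))

m∸n≤o⇒m≤o+n : ∀ {m n o} → m ∸ n ≤ o → m ≤ o + n
m∸n≤o⇒m≤o+n {m} {n} {o} le =
  ≤-trans (m≤n+m∸n m n) (subst (n + (m ∸ n) ≤_) (+-comm n o) (+-monoʳ-≤ n le))

∈-applyUpTo-+ : ∀ {a c i} → a ≤ i → i < a + c → i ∈ applyUpTo (a +_) c
∈-applyUpTo-+ {a} {c} a≤i i<a+c with d , refl ← m≤n⇒∃[o]m+o≡n a≤i =
  ∈-applyUpTo⁺ (a +_) (+-cancelˡ-< a d c i<a+c)

length-filter-split : ∀ {A : Set} {P : A → Set} (P? : ∀ x → Dec (P x)) xs →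
  length xs ≡ length (filter P? xs) + length (filter (¬? ∘ P?) xs)
length-filter-split P? []       = refl
length-filter-split P? (x ∷ xs) with P? x
... | yes _ = cong suc (length-filter-split P? xs)
... | no  _ = trans (cong suc (length-filter-split P? xs)) (sym (+-suc _ _))

module _ {A B : Set} (R : A → B → Set) where

  length-≤-injectiveRel : ∀ xs ys → Unique xs →
    (∀ {a} → a ∈ xs → ∃[ b ] b ∈ ys × R a b) →
    (∀ {a a′ b} → a ∈ xs → a′ ∈ xs → R a b → R a′ b → a ≡ a′) →
    length xs ≤ length ys
  length-≤-injectiveRel []       ys _            _     _   = z≤n
  length-≤-injectiveRel (x ∷ xs) ys (x∉xs ∷ xs!) image inj
    with y , y∈ys , Rxy ← image (here refl)
    with p , q , refl ← ∈-∃++ y∈ys =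
    subst (suc (length xs) ≤_) (sym length-p++y∷q)
      (s≤s (length-≤-injectiveRel xs (p ++ q) xs! image′ (λ a∈ a′∈ → inj (there a∈) (there a′∈))))
    where
    length-p++y∷q : length (p ++ y ∷ q) ≡ suc (length (p ++ q))
    length-p++y∷q = trans (length-++ p) (trans (+-suc (length p) (length q)) (cong suc (sym (length-++ p))))
    image′ : ∀ {a} → a ∈ xs → ∃[ b ] b ∈ p ++ q × R a b
    image′ a∈ with b , b∈ , Rab ← image (there a∈) with ∈-++⁻ p b∈
    ... | inj₁ b∈p         = b , ∈-++⁺ˡ b∈p , Rab
    ... | inj₂ (there b∈q) = b , ∈-++⁺ʳ p b∈q , Rab
    ... | inj₂ (here refl) = ⊥-elim (All.lookup x∉xs a∈ (inj (here refl) (there a∈) Rxy Rab))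

length-≤-⊆ : ∀ {A : Set} (xs ys : List A) → Unique xs → (∀ {a} → a ∈ xs → a ∈ ys) →
  length xs ≤ length ys
length-≤-⊆ xs ys xs! xs⊆ys =
  length-≤-injectiveRel _≡_ xs ys xs! (λ a∈ → _ , xs⊆ys a∈ , refl) (λ _ _ p q → trans p (sym q))

Fits : List ℕ → List (List ℕ) → Set
Fits = Pointwise _∈_

choices : List (List ℕ) → List (List ℕ)
choices []       = [ [] ]
choices (L ∷ Ls) = cartesianProductWith _∷_ L (choices Ls)

length-cartesianProductWith : ∀ {A B C : Set} (f : A → B → C) xs ys →
  length (cartesianProductWith f xs ys) ≡ length xs * length ys
length-cartesianProductWith f []       ys = refl
length-cartesianProductWith f (x ∷ xs) ys =
  trans (length-++ (map (f x) ys)) (cong₂ _+_ (length-map (f x) ys) (length-cartesianProductWith f xs ys))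

∈-choices⁺ : ∀ {Ls w} → Fits w Ls → w ∈ choices Ls
∈-choices⁺ []         = here refl
∈-choices⁺ (x∈L ∷ fw) = ∈-cartesianProductWith⁺ _∷_ x∈L (∈-choices⁺ fw)

∈-choices⁻ : ∀ Ls {w} → w ∈ choices Ls → Fits w Ls
∈-choices⁻ []       (here refl) = []
∈-choices⁻ (L ∷ Ls) w∈
  with _ , _ , x∈L , w′∈ , refl ← ∈-cartesianProductWith⁻ _∷_ L (choices Ls) w∈ =
  x∈L ∷ ∈-choices⁻ Ls w′∈

choices-unique : ∀ Ls → All Unique Ls → Unique (choices Ls)
choices-unique []       _          = [] ∷ []
choices-unique (L ∷ Ls) (L! ∷ Ls!) = Unique.cartesianProductWith⁺ _∷_ ∷-injective L! (choices-unique Ls Ls!)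

fits-take : ∀ m {w Ls} → Fits w Ls → Fits (take m w) (take m Ls)
fits-take zero    _        = []
fits-take (suc m) []       = []
fits-take (suc m) (x ∷ fw) = x ∷ fits-take m fw

fits-drop : ∀ m {w Ls} → Fits w Ls → Fits (drop m w) (drop m Ls)
fits-drop zero    fw       = fw
fits-drop (suc m) []       = []
fits-drop (suc m) (_ ∷ fw) = fits-drop m fw

SquarePrefix : ℕ → List ℕ → Set
SquarePrefix k w = k + k ≤ length w × take k w ≡ take k (drop k w)

HasSquarePrefix : List ℕ → Set
HasSquarePrefix w = ∃[ k ] 1 ≤ k × SquarePrefix k w

hasSquarePrefix? : ∀ w → Dec (HasSquarePrefix w)
hasSquarePrefix? w = map′ (λ (k , _ , sq) → k , sq) bounded
  (anyUpTo? (λ k → (1 ≤? k) ×-dec ((k + k ≤? length w) ×-dec ≡-dec _≟_ (take k w) (take k (drop k w))))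
            (suc (length w)))
  where
  bounded : HasSquarePrefix w → ∃[ k ] k < suc (length w) × 1 ≤ k × SquarePrefix k w
  bounded (k , 1≤k , sq@(kk≤ , _)) = k , s≤s (≤-trans (m≤m+n k k) kk≤) , 1≤k , sq

SquareFree : List ℕ → Set
SquareFree []      = ⊤
SquareFree (x ∷ w) = ¬ HasSquarePrefix (x ∷ w) × SquareFree w

squareFree? : ∀ w → Dec (SquareFree w)
squareFree? []      = yes tt
squareFree? (x ∷ w) = ¬? (hasSquarePrefix? (x ∷ w)) ×-dec squareFree? w

squareFree⇒¬squarePrefix : ∀ {w k} → SquareFree w → 1 ≤ k → ¬ SquarePrefix k w
squareFree⇒¬squarePrefix {[]} {suc _} _ _ (() , _)
squareFree⇒¬squarePrefix {x ∷ w} (sf , _) 1≤k sq = sf (_ , 1≤k , sq)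

-- SquareFree is the decidable form, NoSquareFactor the one visibly closed under factors and reversal.
Square : List ℕ → Set
Square y = ∃[ u ] 1 ≤ length u × y ≡ u ++ u

NoSquareFactor : List ℕ → Set
NoSquareFactor w = ∀ x y z → w ≡ x ++ y ++ z → ¬ Square y

take-length-++ : ∀ (u v : List ℕ) → take (length u) (u ++ v) ≡ u
take-length-++ []      v = refl
take-length-++ (x ∷ u) v = cong (x ∷_) (take-length-++ u v)

drop-length-++ : ∀ (u v : List ℕ) → drop (length u) (u ++ v) ≡ v
drop-length-++ []      v = refl
drop-length-++ (x ∷ u) v = drop-length-++ u v

squarePrefix-++ : ∀ u z → SquarePrefix (length u) (u ++ u ++ z)
squarePrefix-++ u z = length-bound , halves
  where
  length-bound : length u + length u ≤ length (u ++ u ++ z)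
  length-bound = subst (length u + length u ≤_)
    (sym (trans (length-++ u) (cong (length u +_) (length-++ u))))
    (+-monoʳ-≤ (length u) (m≤m+n (length u) (length z)))
  halves : take (length u) (u ++ u ++ z) ≡ take (length u) (drop (length u) (u ++ u ++ z))
  halves = trans (take-length-++ u (u ++ z))
    (sym (trans (cong (take (length u)) (drop-length-++ u (u ++ z))) (take-length-++ u z)))

squarePrefix-split : ∀ k w → SquarePrefix k w → w ≡ take k w ++ take k w ++ drop (k + k) w
squarePrefix-split k w (_ , halves) =
  trans (sym (take++drop≡id k w))
    (cong (take k w ++_) (trans (sym (take++drop≡id k (drop k w)))
      (cong₂ _++_ (sym halves) (drop-drop k k w))))

length-take-≤ : ∀ {A : Set} {k} (w : List A) → k ≤ length w → length (take k w) ≡ k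
length-take-≤ {k = k} w k≤ = trans (length-take k w) (m≤n⇒m⊓n≡m k≤)

squareFree⇒noSquareFactor : ∀ w → SquareFree w → NoSquareFactor w
squareFree⇒noSquareFactor w       sf       []      _ _ _ ([] , () , _)
squareFree⇒noSquareFactor _       (sf , _) []      _ z refl (u@(_ ∷ _) , 1≤ , refl) =
  sf (length u , 1≤ , subst (SquarePrefix (length u)) (sym (++-assoc u u z)) (squarePrefix-++ u z))
squareFree⇒noSquareFactor (a ∷ w) (_ , sf) (b ∷ x) y z eq =
  squareFree⇒noSquareFactor w sf x y z (∷-injectiveʳ eq)

noSquareFactor⇒squareFree : ∀ w → NoSquareFactor w → SquareFree w
noSquareFactor⇒squareFree []      _   = tt
noSquareFactor⇒squareFree (a ∷ w) nsf =
  noSquarePrefix , noSquareFactor⇒squareFree w (λ x y z eq → nsf (a ∷ x) y z (cong (a ∷_) eq))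
  where
  noSquarePrefix : ¬ HasSquarePrefix (a ∷ w)
  noSquarePrefix (k , 1≤k , sq@(kk≤ , _)) =
    nsf [] (u ++ u) (drop (k + k) (a ∷ w))
      (trans (squarePrefix-split k (a ∷ w) sq) (sym (++-assoc u u _)))
      (u , subst (1 ≤_) (sym (length-take-≤ (a ∷ w) (≤-trans (m≤m+n k k) kk≤))) 1≤k , refl)
    where u = take k (a ∷ w)

noSquareFactor-reverse : ∀ w → NoSquareFactor w → NoSquareFactor (reverse w)
noSquareFactor-reverse w nsf x _ z eq (u , 1≤u , refl) =
  nsf (reverse z) (reverse u ++ reverse u) (reverse x) w≡
    (reverse u , subst (1 ≤_) (sym (length-reverse u)) 1≤u , refl)
  where
  open ≡-Reasoning
  w≡ : w ≡ reverse z ++ (reverse u ++ reverse u) ++ reverse x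
  w≡ = begin
    w                                             ≡⟨ sym (reverse-involutive w) ⟩
    reverse (reverse w)                           ≡⟨ cong reverse eq ⟩
    reverse (x ++ (u ++ u) ++ z)                  ≡⟨ reverse-++ x _ ⟩
    reverse ((u ++ u) ++ z) ++ reverse x          ≡⟨ cong (_++ reverse x) (reverse-++ (u ++ u) z) ⟩
    (reverse z ++ reverse (u ++ u)) ++ reverse x  ≡⟨ ++-assoc (reverse z) _ _ ⟩
    reverse z ++ reverse (u ++ u) ++ reverse x    ≡⟨ cong (λ t → reverse z ++ t ++ reverse x) (reverse-++ u u) ⟩
    reverse z ++ (reverse u ++ reverse u) ++ reverse x ∎

noSquareFactor-drop : ∀ m w → NoSquareFactor w → NoSquareFactor (drop m w)
noSquareFactor-drop m w nsf x y z eq = nsf (take m w ++ x) y z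
  (trans (sym (take++drop≡id m w)) (trans (cong (take m w ++_) eq) (sym (++-assoc (take m w) x _))))

noSquareFactor-take : ∀ m w → NoSquareFactor w → NoSquareFactor (take m w)
noSquareFactor-take m w nsf x y z eq = nsf x y (z ++ drop m w)
  (trans (sym (take++drop≡id m w)) (trans (cong (_++ drop m w) eq)
    (trans (++-assoc x _ _) (cong (x ++_) (++-assoc y z _)))))

squareFree-reverse : ∀ w → SquareFree w → SquareFree (reverse w)
squareFree-reverse w sf = noSquareFactor⇒squareFree _ (noSquareFactor-reverse w (squareFree⇒noSquareFactor w sf))

squareFree-take : ∀ m w → SquareFree w → SquareFree (take m w)
squareFree-take m w sf = noSquareFactor⇒squareFree _ (noSquareFactor-take m w (squareFree⇒noSquareFactor w sf))

squareFree-drop : ∀ m w → SquareFree w → SquareFree (drop m w)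
squareFree-drop m w sf = noSquareFactor⇒squareFree _ (noSquareFactor-drop m w (squareFree⇒noSquareFactor w sf))

squarePrefix-injective : ∀ {k k′ a b} → SquarePrefix k a → SquarePrefix k′ b →
  length a ≡ length b → drop k a ≡ drop k′ b → a ≡ b
squarePrefix-injective {k} {k′} {a} {b} (kk≤ , halves) (kk≤′ , halves′) |a|≡|b| tails with k≡k′
  where
  k≡k′ : k ≡ k′
  k≡k′ = ∸-cancelˡ-≡ (≤-trans (m≤m+n k k) kk≤)
                     (subst (k′ ≤_) (sym |a|≡|b|) (≤-trans (m≤m+n k′ k′) kk≤′))
    (trans (sym (length-drop k a))
      (trans (cong length tails) (trans (length-drop k′ b) (cong (_∸ k′) (sym |a|≡|b|)))))
... | refl = begin
  a                                ≡⟨ sym (take++drop≡id k a) ⟩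
  take k a ++ drop k a             ≡⟨ cong (_++ drop k a) halves ⟩
  take k (drop k a) ++ drop k a    ≡⟨ cong (λ t → take k t ++ t) tails ⟩
  take k (drop k b) ++ drop k b    ≡⟨ cong (_++ drop k b) (sym halves′) ⟩
  take k b ++ drop k b             ≡⟨ take++drop≡id k b ⟩
  b                                ∎
  where open ≡-Reasoning

Admissible : List (List ℕ) → Set
Admissible = All (λ L → Unique L × 5 ≤ length L)

sqFree : List (List ℕ) → List (List ℕ)
sqFree Ls = filter squareFree? (choices Ls)

#sqFree : List (List ℕ) → ℕ
#sqFree Ls = length (sqFree Ls)

sqFree-unique : ∀ Ls → Admissible Ls → Unique (sqFree Ls)
sqFree-unique Ls adm = Unique.filter⁺ squareFree? (choices-unique Ls (All.map proj₁ adm))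

∈-sqFree⁺ : ∀ {Ls w} → Fits w Ls → SquareFree w → w ∈ sqFree Ls
∈-sqFree⁺ fw sf = ∈-filter⁺ squareFree? (∈-choices⁺ fw) sf

∈-sqFree⁻ : ∀ Ls {w} → w ∈ sqFree Ls → Fits w Ls × SquareFree w
∈-sqFree⁻ Ls w∈ with w∈choices , sf ← ∈-filter⁻ squareFree? w∈ = ∈-choices⁻ Ls w∈choices , sf

suffixWords : List (List ℕ) → List (List ℕ)
suffixWords []       = []
suffixWords (L ∷ Ls) = sqFree (L ∷ Ls) ++ suffixWords Ls

∈-suffixWords⁺ : ∀ j Ls {u} → j < length Ls → u ∈ sqFree (drop j Ls) → u ∈ suffixWords Ls
∈-suffixWords⁺ zero    (L ∷ Ls) _       u∈ = ∈-++⁺ˡ u∈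
∈-suffixWords⁺ (suc j) (L ∷ Ls) (s≤s j<) u∈ = ∈-++⁺ʳ (sqFree (L ∷ Ls)) (∈-suffixWords⁺ j Ls j< u∈)

#sqFree-extension : ∀ L Ls → Admissible (L ∷ Ls) →
  5 * #sqFree Ls ≤ #sqFree (L ∷ Ls) + length (suffixWords Ls)
#sqFree-extension L Ls ((L! , 5≤|L|) ∷ adm) = begin
  5 * #sqFree Ls                         ≤⟨ *-monoˡ-≤ (#sqFree Ls) 5≤|L| ⟩
  length L * #sqFree Ls                  ≡⟨ sym (length-cartesianProductWith _∷_ L (sqFree Ls)) ⟩
  length E                               ≡⟨ length-filter-split squareFree? E ⟩
  length good + length bad               ≤⟨ +-mono-≤ good-bound bad-bound ⟩
  #sqFree (L ∷ Ls) + length (suffixWords Ls) ∎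
  where
  open ≤-Reasoning
  E good bad : List (List ℕ)
  E    = cartesianProductWith _∷_ L (sqFree Ls)
  good = filter squareFree? E
  bad  = filter (¬? ∘ squareFree?) E

  E-unique : Unique E
  E-unique = Unique.cartesianProductWith⁺ _∷_ ∷-injective L! (sqFree-unique Ls adm)

  ∈-E⁻ : ∀ {v} → v ∈ E → ∃[ x ] ∃[ w ] v ≡ x ∷ w × Fits v (L ∷ Ls) × SquareFree w
  ∈-E⁻ v∈ with x , w , x∈L , w∈ , refl ← ∈-cartesianProductWith⁻ _∷_ L (sqFree Ls) v∈
    with fw , sf ← ∈-sqFree⁻ Ls w∈ = x , w , refl , x∈L ∷ fw , sf

  good-bound : length good ≤ #sqFree (L ∷ Ls)
  good-bound = length-≤-⊆ good (sqFree (L ∷ Ls)) (Unique.filter⁺ squareFree? E-unique) good⊆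
    where
    good⊆ : ∀ {v} → v ∈ good → v ∈ sqFree (L ∷ Ls)
    good⊆ v∈ with v∈E , sf ← ∈-filter⁻ squareFree? v∈ with _ , _ , _ , fv , _ ← ∈-E⁻ v∈E =
      ∈-sqFree⁺ fv sf

  SuffixAfterSquare : List ℕ → List ℕ → Set
  SuffixAfterSquare v u = ∃[ k ] 1 ≤ k × SquarePrefix k v × u ≡ drop k v

  ∈-bad⁻ : ∀ {v} → v ∈ bad →
    Fits v (L ∷ Ls) × ∃[ x ] ∃[ w ] v ≡ x ∷ w × SquareFree w × HasSquarePrefix v
  ∈-bad⁻ v∈ with v∈E , ¬sf ← ∈-filter⁻ (¬? ∘ squareFree?) v∈ with ∈-E⁻ v∈E
  ... | x , w , refl , fv , sf with hasSquarePrefix? (x ∷ w)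
  ...   | yes sq = fv , x , w , refl , sf , sq
  ...   | no ¬sq = ⊥-elim (¬sf (¬sq , sf))

  bad-image : ∀ {v} → v ∈ bad → ∃[ u ] u ∈ suffixWords Ls × SuffixAfterSquare v u
  bad-image v∈ with ∈-bad⁻ v∈
  ... | _ ∷ fw , x , w , refl , sf , (suc j , 1≤k , sq@(kk≤ , _)) =
    drop j w ,
    ∈-suffixWords⁺ j Ls j<|Ls| (∈-sqFree⁺ (fits-drop j fw) (squareFree-drop j w sf)) ,
    suc j , 1≤k , sq , refl
    where
    j<|Ls| : j < length Ls
    j<|Ls| = subst (j <_) (Pointwise-length fw) (≤-trans (m≤n+m (suc j) j) (≤-pred kk≤))

  bad-bound : length bad ≤ length (suffixWords Ls)
  bad-bound = length-≤-injectiveRel SuffixAfterSquare bad (suffixWords Ls)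
    (Unique.filter⁺ (¬? ∘ squareFree?) E-unique) bad-image
    λ { a∈ a′∈ (_ , _ , sq , refl) (_ , _ , sq′ , tails) →
          squarePrefix-injective sq sq′ (trans (|v|≡1+|Ls| a∈) (sym (|v|≡1+|Ls| a′∈))) tails }
    where
    |v|≡1+|Ls| : ∀ {v} → v ∈ bad → length v ≡ suc (length Ls)
    |v|≡1+|Ls| v∈ = Pointwise-length (proj₁ (∈-bad⁻ v∈))

growth-inequalities : ∀ a b s → 5 * a ≤ b + s → 2 * s ≤ 3 * a → 3 * a ≤ b × 2 * (b + s) ≤ 3 * b
growth-inequalities a b s 5a≤b+s 2s≤3a = 3a≤b , 2[b+s]≤3b
  where
  open ≤-Reasoning
  9x≡ : ∀ x → 2 * (3 * x) + 3 * x ≡ 9 * x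
  9x≡ = solve-∀
  2[b+s]≤2b+3a : 2 * (b + s) ≤ 2 * b + 3 * a
  2[b+s]≤2b+3a = begin
    2 * (b + s)     ≡⟨ *-distribˡ-+ 2 b s ⟩
    2 * b + 2 * s   ≤⟨ +-monoʳ-≤ (2 * b) 2s≤3a ⟩
    2 * b + 3 * a   ∎
  3a≤b : 3 * a ≤ b
  3a≤b = *-cancelˡ-≤ 2 (+-cancelʳ-≤ (3 * a) (2 * (3 * a)) (2 * b) (begin
    2 * (3 * a) + 3 * a   ≡⟨ 9x≡ a ⟩
    9 * a                 ≤⟨ *-monoˡ-≤ a (n≤1+n 9) ⟩
    10 * a                ≡⟨ *-assoc 2 5 a ⟩
    2 * (5 * a)           ≤⟨ *-monoʳ-≤ 2 5a≤b+s ⟩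
    2 * (b + s)           ≤⟨ 2[b+s]≤2b+3a ⟩
    2 * b + 3 * a         ∎))
  2[b+s]≤3b : 2 * (b + s) ≤ 3 * b
  2[b+s]≤3b = begin
    2 * (b + s)     ≤⟨ 2[b+s]≤2b+3a ⟩
    2 * b + 3 * a   ≤⟨ +-monoʳ-≤ (2 * b) 3a≤b ⟩
    2 * b + b       ≡⟨ +-comm (2 * b) b ⟩
    3 * b           ∎

extension-growth : ∀ L Ls → Admissible (L ∷ Ls) → 2 * length (suffixWords Ls) ≤ 3 * #sqFree Ls →
  3 * #sqFree Ls ≤ #sqFree (L ∷ Ls) × 2 * length (suffixWords (L ∷ Ls)) ≤ 3 * #sqFree (L ∷ Ls)
extension-growth L Ls adm 2s≤3a =
  proj₁ growth ,
  subst (λ t → 2 * t ≤ 3 * #sqFree (L ∷ Ls)) (sym (length-++ (sqFree (L ∷ Ls)))) (proj₂ growth)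
  where
  growth = growth-inequalities (#sqFree Ls) (#sqFree (L ∷ Ls)) (length (suffixWords Ls))
                               (#sqFree-extension L Ls adm) 2s≤3a

suffixWords-bound : ∀ Ls → Admissible Ls → 2 * length (suffixWords Ls) ≤ 3 * #sqFree Ls
suffixWords-bound []       _             = z≤n
suffixWords-bound (L ∷ Ls) adm@(_ ∷ adm′) = proj₂ (extension-growth L Ls adm (suffixWords-bound Ls adm′))

#sqFree-∷ : ∀ L Ls → Admissible (L ∷ Ls) → 3 * #sqFree Ls ≤ #sqFree (L ∷ Ls)
#sqFree-∷ L Ls adm@(_ ∷ adm′) = proj₁ (extension-growth L Ls adm (suffixWords-bound Ls adm′))

#sqFree-++ : ∀ Ks Ls → Admissible (Ks ++ Ls) → 3 ^ length Ks * #sqFree Ls ≤ #sqFree (Ks ++ Ls)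
#sqFree-++ []       Ls _             = ≤-reflexive (+-identityʳ (#sqFree Ls))
#sqFree-++ (K ∷ Ks) Ls adm@(_ ∷ adm′) = begin
  3 * 3 ^ length Ks * #sqFree Ls    ≡⟨ *-assoc 3 (3 ^ length Ks) (#sqFree Ls) ⟩
  3 * (3 ^ length Ks * #sqFree Ls)  ≤⟨ *-monoʳ-≤ 3 (#sqFree-++ Ks Ls adm′) ⟩
  3 * #sqFree (Ks ++ Ls)            ≤⟨ #sqFree-∷ K (Ks ++ Ls) adm ⟩
  #sqFree (K ∷ Ks ++ Ls)            ∎
  where open ≤-Reasoning

#sqFree-exponential : ∀ Ls → Admissible Ls → 3 ^ length Ls ≤ #sqFree Ls
#sqFree-exponential Ls adm =
  subst₂ (λ m Ks → m ≤ #sqFree Ks) (*-identityʳ (3 ^ length Ls)) (++-identityʳ Ls)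
    (#sqFree-++ Ls [] (subst Admissible (sym (++-identityʳ Ls)) adm))

admissible-reverse : ∀ {Ls} → Admissible Ls → Admissible (reverse Ls)
admissible-reverse adm = All.tabulate (λ L∈ → All.lookup adm (Any.reverse⁻ L∈))

#sqFree-reverse-≤ : ∀ Ls → Admissible Ls → #sqFree Ls ≤ #sqFree (reverse Ls)
#sqFree-reverse-≤ Ls adm =
  length-≤-injectiveRel (λ w u → u ≡ reverse w) (sqFree Ls) (sqFree (reverse Ls)) (sqFree-unique Ls adm)
    reverse-image (λ _ _ p q → reverse-injective (trans (sym p) q))
  where
  reverse-image : ∀ {w} → w ∈ sqFree Ls → ∃[ u ] u ∈ sqFree (reverse Ls) × u ≡ reverse w
  reverse-image w∈ with fw , sf ← ∈-sqFree⁻ Ls w∈ =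
    _ , ∈-sqFree⁺ (Pointwise.reverse⁺ fw) (squareFree-reverse _ sf) , refl

#sqFree-reverse : ∀ Ls → Admissible Ls → #sqFree (reverse Ls) ≡ #sqFree Ls
#sqFree-reverse Ls adm = ≤-antisym
  (subst (λ Ks → #sqFree (reverse Ls) ≤ #sqFree Ks) (reverse-involutive Ls)
    (#sqFree-reverse-≤ (reverse Ls) (admissible-reverse adm)))
  (#sqFree-reverse-≤ Ls adm)

#sqFree-drop : ∀ k Ls → Admissible Ls → k ≤ length Ls → 3 ^ k * #sqFree (drop k Ls) ≤ #sqFree Ls
#sqFree-drop k Ls adm k≤ =
  subst₂ (λ m Ks → 3 ^ m * #sqFree (drop k Ls) ≤ #sqFree Ks) (length-take-≤ Ls k≤) (take++drop≡id k Ls)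
    (#sqFree-++ (take k Ls) (drop k Ls) (subst Admissible (sym (take++drop≡id k Ls)) adm))

#sqFree-take : ∀ q Ls → Admissible Ls → 3 ^ (length Ls ∸ q) * #sqFree (take q Ls) ≤ #sqFree Ls
#sqFree-take q Ls adm = begin
  3 ^ (length Ls ∸ q) * #sqFree (take q Ls)
    ≡⟨ cong₂ (λ m c → 3 ^ m * c) |rev-drop| (sym (#sqFree-reverse (take q Ls) (All.take⁺ q adm))) ⟩
  3 ^ length (reverse (drop q Ls)) * #sqFree (reverse (take q Ls))
    ≤⟨ #sqFree-++ (reverse (drop q Ls)) (reverse (take q Ls)) (subst Admissible rev≡ (admissible-reverse adm)) ⟩
  #sqFree (reverse (drop q Ls) ++ reverse (take q Ls))  ≡⟨ cong #sqFree (sym rev≡) ⟩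
  #sqFree (reverse Ls)                                  ≡⟨ #sqFree-reverse Ls adm ⟩
  #sqFree Ls                                            ∎
  where
  open ≤-Reasoning
  |rev-drop| : length Ls ∸ q ≡ length (reverse (drop q Ls))
  |rev-drop| = sym (trans (length-reverse (drop q Ls)) (length-drop q Ls))
  rev≡ : reverse Ls ≡ reverse (drop q Ls) ++ reverse (take q Ls)
  rev≡ = trans (cong reverse (sym (take++drop≡id q Ls))) (reverse-++ (take q Ls) (drop q Ls))

module Cyclic (n : ℕ) {{_ : NonZero n}} where

  CyclicSquare : List ℕ → ℕ → ℕ → Set
  CyclicSquare w i k = ∀ {j} → j < k → at w ((i + j) % n) ≡ at w ((i + (k + j)) % n)

  HasCyclicSquare : List ℕ → Set
  HasCyclicSquare w = ∃[ i ] ∃[ k ] i < n × 1 ≤ k × k + k ≤ n × CyclicSquare w i k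

  hasCyclicSquare? : ∀ w → Dec (HasCyclicSquare w)
  hasCyclicSquare? w = map′ (λ (i , i<n , k , _ , sq) → i , k , i<n , sq) bounded
    (anyUpTo? (λ i → anyUpTo? (λ k → (1 ≤? k) ×-dec ((k + k ≤? n) ×-dec
       allUpTo? (λ j → at w ((i + j) % n) ≟ at w ((i + (k + j)) % n)) k)) (suc n)) n)
    where
    bounded : HasCyclicSquare w → ∃[ i ] i < n × ∃[ k ] k < suc n × 1 ≤ k × k + k ≤ n × CyclicSquare w i k
    bounded (i , k , i<n , 1≤k , kk≤n , sq) = i , i<n , k , s≤s (≤-trans (m≤m+n k k) kk≤n) , 1≤k , kk≤n , sq

  [m%n+k]%n≡[m+k]%n : ∀ m k → (m % n + k) % n ≡ (m + k) % n
  [m%n+k]%n≡[m+k]%n m k = begin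
    (m % n + k) % n              ≡⟨ %-distribˡ-+ (m % n) k n ⟩
    (m % n % n + k % n) % n      ≡⟨ cong (λ x → (x + k % n) % n) (m%n%n≡m%n m n) ⟩
    (m % n + k % n) % n          ≡⟨ sym (%-distribˡ-+ m k n) ⟩
    (m + k) % n                  ∎
    where open ≡-Reasoning

  cyclicSquare-% : ∀ {w i k} → CyclicSquare w i k → CyclicSquare w (i % n) k
  cyclicSquare-% {w} {i} {k} sq {j} j<k =
    trans (cong (at w) ([m%n+k]%n≡[m+k]%n i j)) (trans (sq j<k) (cong (at w) (sym ([m%n+k]%n≡[m+k]%n i (k + j)))))

  %-≡-+ : ∀ {q r} → q ≡ n + r → r < n → q % n ≡ r
  %-≡-+ {q} {r} refl r<n = trans (cong (_% n) (+-comm n r)) (trans ([m+n]%n≡m%n r n) (m<n⇒m%n≡m r<n))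

  cyclicSquare-wraps : ∀ {w i k} → length w ≡ n → SquareFree w → 1 ≤ k → CyclicSquare w i k →
    n < i + (k + k)
  cyclicSquare-wraps {w} {i} {k} |w|≡n sf 1≤k sq with i + (k + k) ≤? n
  ... | no  ≰n = ≰⇒> ≰n
  ... | yes ≤n = ⊥-elim (squareFree⇒¬squarePrefix (squareFree-drop i w sf) 1≤k (kk≤|d| , halves))
    where
    d = drop i w
    kk≤|d| : k + k ≤ length d
    kk≤|d| = subst (k + k ≤_) (sym (trans (length-drop i w) (cong (_∸ i) |w|≡n)))
      (m+n≤o⇒m≤o∸n (k + k) (subst (_≤ n) (+-comm i (k + k)) ≤n))
    |take-d| : length (take k d) ≡ k
    |take-d| = length-take-≤ d (≤-trans (m≤m+n k k) kk≤|d|)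
    |take-drop-d| : length (take k (drop k d)) ≡ k
    |take-drop-d| = length-take-≤ (drop k d) (subst (k ≤_) (sym (length-drop k d)) (m+n≤o⇒m≤o∸n k kk≤|d|))
    letters : ∀ j → j < k → at (take k d) j ≡ at (take k (drop k d)) j
    letters j j<k = begin
      at (take k d) j            ≡⟨ at-take k d j j<k ⟩
      at d j                     ≡⟨ at-drop i w j ⟩
      at w (i + j)               ≡⟨ cong (at w) (sym (m<n⇒m%n≡m i+j<n)) ⟩
      at w ((i + j) % n)         ≡⟨ sq j<k ⟩
      at w ((i + (k + j)) % n)   ≡⟨ cong (at w) (m<n⇒m%n≡m i+k+j<n) ⟩
      at w (i + (k + j))         ≡⟨ sym (at-drop i w (k + j)) ⟩
      at d (k + j)               ≡⟨ sym (at-drop k d j) ⟩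
      at (drop k d) j            ≡⟨ sym (at-take k (drop k d) j j<k) ⟩
      at (take k (drop k d)) j   ∎
      where
      open ≡-Reasoning
      i+k+j<n : i + (k + j) < n
      i+k+j<n = <-≤-trans (+-monoʳ-< i (+-monoʳ-< k j<k)) ≤n
      i+j<n : i + j < n
      i+j<n = ≤-<-trans (+-monoʳ-≤ i (m≤n+m j k)) i+k+j<n
    halves : take k d ≡ take k (drop k d)
    halves = at-extensionality _ _ (trans |take-d| (sym |take-drop-d|))
      (λ j j< → letters j (subst (j <_) |take-d| j<))

  module Determination {a b i k} (|a|≡n : length a ≡ n) (|b|≡n : length b ≡ n)
                       (sqa : CyclicSquare a i k) (sqb : CyclicSquare b i k) where

    linked : ∀ {j p q} → j < k → (i + j) % n ≡ p → (i + (k + j)) % n ≡ q →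
      at a q ≡ at b q → at a p ≡ at b p
    linked j<k refl refl eq = trans (sqa j<k) (trans eq (sym (sqb j<k)))

    linked′ : ∀ {j p q} → j < k → (i + j) % n ≡ p → (i + (k + j)) % n ≡ q →
      at a p ≡ at b p → at a q ≡ at b q
    linked′ j<k refl refl eq = trans (sym (sqa j<k)) (trans eq (sqb j<k))

    agree-everywhere : (∀ p → p < n → at a p ≡ at b p) → a ≡ b
    agree-everywhere agree =
      at-extensionality a b (trans |a|≡n (sym |b|≡n)) (λ p p< → agree p (subst (p <_) |a|≡n p<))

    determined-by-prefix : k + k ≤ n → n < i + (k + k) → i + k ≤ n →
      take (n ∸ k) a ≡ take (n ∸ k) b → a ≡ b
    determined-by-prefix kk≤n wraps i+k≤n prefix = agree-everywhere agree
      where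
      k≤n∸k : k ≤ n ∸ k
      k≤n∸k = m+n≤o⇒m≤o∸n k kk≤n
      known : ∀ {p} → p < n ∸ k → at a p ≡ at b p
      known {p} p< =
        trans (sym (at-take (n ∸ k) a p p<)) (trans (cong (λ t → at t p) prefix) (at-take (n ∸ k) b p p<))
      second-half : ∀ {j} → i + k + j < n → at a (i + k + j) ≡ at b (i + k + j)
      second-half {j} p<n = linked′ j<k (m<n⇒m%n≡m (<-≤-trans i+j<n∸k (m∸n≤m n k)))
          (trans (cong (_% n) (sym (+-assoc i k j))) (m<n⇒m%n≡m p<n)) (known i+j<n∸k)
        where
        j<k : j < k
        j<k = +-cancelˡ-< (i + k) j k (<-trans p<n (subst (n <_) (sym (+-assoc i k k)) wraps))
        i+j<n∸k : i + j < n ∸ k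
        i+j<n∸k = m+n≤o⇒m≤o∸n (suc (i + j)) (subst (λ t → suc t ≤ n) (+-right-comm i k j) p<n)
      first-half : ∀ {t} → i + t < n → n ∸ k ≤ i + t → t < k → at a (i + t) ≡ at b (i + t)
      first-half {t} p<n n∸k≤p t<k with r , n+r≡p+k ← m≤n⇒∃[o]m+o≡n (m∸n≤o⇒m≤o+n n∸k≤p) =
        linked t<k (m<n⇒m%n≡m p<n) (%-≡-+ partner (<-≤-trans r<k (≤-trans k≤n∸k (m∸n≤m n k))))
          (known (<-≤-trans r<k k≤n∸k))
        where
        partner : i + (k + t) ≡ n + r
        partner = trans (trans (sym (+-assoc i k t)) (+-right-comm i k t)) (sym n+r≡p+k)
        r<k : r < k
        r<k = +-cancelˡ-< n r k (subst (_< n + k) (sym n+r≡p+k) (+-monoˡ-< k p<n))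
      agree : ∀ p → p < n → at a p ≡ at b p
      agree p p<n with p <? n ∸ k | i + k ≤? p
      ... | yes p<n∸k | _ = known p<n∸k
      ... | no  _     | yes i+k≤p with j , refl ← m≤n⇒∃[o]m+o≡n i+k≤p = second-half p<n
      ... | no  p≮n∸k | no  i+k≰p
        with t , refl ← m≤n⇒∃[o]m+o≡n (≤-trans (m+n≤o⇒m≤o∸n i i+k≤n) (≮⇒≥ p≮n∸k)) =
        first-half p<n (≮⇒≥ p≮n∸k) (+-cancelˡ-< i t k (≰⇒> i+k≰p))

    determined-by-suffix : k + k ≤ n → i < n → n < i + k → drop k a ≡ drop k b → a ≡ b
    determined-by-suffix kk≤n i<n n<i+k suffix = agree-everywhere agree
      where
      known : ∀ {q} → k ≤ q → at a q ≡ at b q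
      known k≤q with r , refl ← m≤n⇒∃[o]m+o≡n k≤q =
        trans (sym (at-drop k a r)) (trans (cong (λ t → at t r) suffix) (at-drop k b r))
      p<k⇒p<n : ∀ {p} → p < k → p < n
      p<k⇒p<n p<k = <-≤-trans p<k (≤-trans (m≤m+n k k) kk≤n)
      wrapped-first-half : ∀ {t p} → i + t ≡ n + p → p < k → t < k → at a p ≡ at b p
      wrapped-first-half {t} {p} i+t≡n+p p<k t<k =
        linked t<k (%-≡-+ i+t≡n+p (p<k⇒p<n p<k)) (%-≡-+ partner (<-≤-trans (+-monoʳ-< k p<k) kk≤n))
          (known (m≤m+n k p))
        where
        partner : i + (k + t) ≡ n + (k + p)
        partner = begin
          i + (k + t)  ≡⟨ sym (+-assoc i k t) ⟩
          i + k + t    ≡⟨ +-right-comm i k t ⟩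
          i + t + k    ≡⟨ cong (_+ k) i+t≡n+p ⟩
          n + p + k    ≡⟨ +-assoc n p k ⟩
          n + (p + k)  ≡⟨ cong (n +_) (+-comm p k) ⟩
          n + (k + p)  ∎
          where open ≡-Reasoning
      wrapped-second-half : ∀ {j p} → i + k + j ≡ n + p → p < k → at a p ≡ at b p
      wrapped-second-half {j} {p} i+k+j≡n+p p<k =
        linked′ j<k (m<n⇒m%n≡m i+j<n) (%-≡-+ (trans (sym (+-assoc i k j)) i+k+j≡n+p) (p<k⇒p<n p<k))
          (known k≤i+j)
        where
        i+j+k≡n+p : i + j + k ≡ n + p
        i+j+k≡n+p = trans (+-right-comm i j k) i+k+j≡n+p
        j<k : j < k
        j<k = +-cancelˡ-< (i + k) j k (subst (_< i + k + k) (sym i+k+j≡n+p) (+-mono-< n<i+k p<k))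
        i+j<n : i + j < n
        i+j<n = +-cancelʳ-< k (i + j) n (subst (_< n + k) (sym i+j+k≡n+p) (+-monoʳ-< n p<k))
        k≤i+j : k ≤ i + j
        k≤i+j = +-cancelʳ-≤ k k (i + j) (≤-trans kk≤n (≤-trans (m≤m+n n p) (≤-reflexive (sym i+j+k≡n+p))))
      agree : ∀ p → p < n → at a p ≡ at b p
      agree p p<n with k ≤? p | i + k ≤? n + p
      ... | yes k≤p | _ = known k≤p
      ... | no  k≰p | yes i+k≤n+p with j , i+k+j≡n+p ← m≤n⇒∃[o]m+o≡n i+k≤n+p =
        wrapped-second-half i+k+j≡n+p (≰⇒> k≰p)
      ... | no  k≰p | no  i+k≰n+p with t , i+t≡n+p ← m≤n⇒∃[o]m+o≡n (≤-trans (<⇒≤ i<n) (m≤m+n n p)) =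
        wrapped-first-half i+t≡n+p (≰⇒> k≰p)
          (+-cancelˡ-< i t k (subst (_< i + k) (sym i+t≡n+p) (≰⇒> i+k≰n+p)))

  -- The letters of w outside one half of a wrapping square: a prefix of w when the first half ends
  -- inside w, a suffix otherwise.  Either way it is a factor of w, hence square-free.
  window : ∀ {A : Set} → ℕ → ℕ → List A → List A
  window i k with i + k ≤? n
  ... | yes _ = take (n ∸ k)
  ... | no  _ = drop k

  fits-window : ∀ i k {w Ls} → Fits w Ls → Fits (window i k w) (window i k Ls)
  fits-window i k fw with i + k ≤? n
  ... | yes _ = fits-take (n ∸ k) fw
  ... | no  _ = fits-drop k fw

  squareFree-window : ∀ i k {w} → SquareFree w → SquareFree (window i k w)
  squareFree-window i k {w} sf with i + k ≤? n
  ... | yes _ = squareFree-take (n ∸ k) w sf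
  ... | no  _ = squareFree-drop k w sf

  length-window : ∀ {A : Set} i k (w : List A) → length w ≡ n → k ≤ n → length (window i k w) ≡ n ∸ k
  length-window i k w |w|≡n k≤n with i + k ≤? n
  ... | yes _ = length-take-≤ w (subst (n ∸ k ≤_) (sym |w|≡n) (m∸n≤m n k))
  ... | no  _ = trans (length-drop k w) (cong (_∸ k) |w|≡n)

  #sqFree-window : ∀ i k Ls → Admissible Ls → length Ls ≡ n → k ≤ n →
    3 ^ k * #sqFree (window i k Ls) ≤ #sqFree Ls
  #sqFree-window i k Ls adm |Ls|≡n k≤n with i + k ≤? n
  ... | yes _ = subst (λ m → 3 ^ m * #sqFree (take (n ∸ k) Ls) ≤ #sqFree Ls)
                  (trans (cong (_∸ (n ∸ k)) |Ls|≡n) (m∸[m∸n]≡n k≤n)) (#sqFree-take (n ∸ k) Ls adm)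
  ... | no  _ = #sqFree-drop k Ls adm (subst (k ≤_) (sym |Ls|≡n) k≤n)

  window-half-length : ∀ {a b : List ℕ} {i i′ k k′} → length a ≡ n → length b ≡ n → k ≤ n → k′ ≤ n →
    window i k a ≡ window i′ k′ b → k ≡ k′
  window-half-length {a} {b} {i} {i′} {k} {k′} |a|≡n |b|≡n k≤n k′≤n eq = ∸-cancelˡ-≡ k≤n k′≤n
    (trans (sym (length-window i k a |a|≡n k≤n)) (trans (cong length eq) (length-window i′ k′ b |b|≡n k′≤n)))

  window-determines : ∀ {a b i k k′} → length a ≡ n → length b ≡ n →
    CyclicSquare a i k → CyclicSquare b i k′ → k + k ≤ n → k′ + k′ ≤ n → i < n → n < i + (k + k) →
    window i k a ≡ window i k′ b → a ≡ b
  window-determines {a} {b} {i} {k} {k′} |a|≡n |b|≡n sqa sqb kk≤n k′k′≤n i<n wraps eq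
    with refl ← window-half-length {i = i} {i} |a|≡n |b|≡n
                  (≤-trans (m≤m+n k k) kk≤n) (≤-trans (m≤m+n k′ k′) k′k′≤n) eq
    with i + k ≤? n
  ... | yes i+k≤n = determined-by-prefix kk≤n wraps i+k≤n eq
    where open Determination {a} {b} {i} {k} |a|≡n |b|≡n sqa sqb
  ... | no  i+k≰n = determined-by-suffix kk≤n i<n (≰⇒> i+k≰n) eq
    where open Determination {a} {b} {i} {k} |a|≡n |b|≡n sqa sqb

  module _ (Ls : List (List ℕ)) (|Ls|≡n : length Ls ≡ n) (adm : Admissible Ls) where

    markedWindows : ℕ → List ℕ → List (List ℕ)
    markedWindows k []       = []
    markedWindows k (i ∷ is) = map (i ∷_) (sqFree (window i k Ls)) ++ markedWindows k is

    ∈-markedWindows⁺ : ∀ {k is i u} → i ∈ is → u ∈ sqFree (window i k Ls) → (i ∷ u) ∈ markedWindows k is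
    ∈-markedWindows⁺ {is = i ∷ is} (here refl) u∈ = ∈-++⁺ˡ (∈-map⁺ (i ∷_) u∈)
    ∈-markedWindows⁺ {k} {i′ ∷ is} (there i∈) u∈ =
      ∈-++⁺ʳ (map (i′ ∷_) (sqFree (window i′ k Ls))) (∈-markedWindows⁺ i∈ u∈)

    markedWindows-bound : ∀ k is → k ≤ n → 3 ^ k * length (markedWindows k is) ≤ length is * #sqFree Ls
    markedWindows-bound k []       _   = ≤-reflexive (*-zeroʳ (3 ^ k))
    markedWindows-bound k (i ∷ is) k≤n = begin
      3 ^ k * length (map (i ∷_) (sqFree (window i k Ls)) ++ markedWindows k is)
        ≡⟨ cong (3 ^ k *_) (trans (length-++ (map (i ∷_) W))
                                  (cong (_+ length (markedWindows k is)) (length-map (i ∷_) W))) ⟩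
      3 ^ k * (#sqFree (window i k Ls) + length (markedWindows k is))
        ≡⟨ *-distribˡ-+ (3 ^ k) (#sqFree (window i k Ls)) _ ⟩
      3 ^ k * #sqFree (window i k Ls) + 3 ^ k * length (markedWindows k is)
        ≤⟨ +-mono-≤ (#sqFree-window i k Ls adm |Ls|≡n k≤n) (markedWindows-bound k is k≤n) ⟩
      #sqFree Ls + length is * #sqFree Ls ∎
      where
      open ≤-Reasoning
      W = sqFree (window i k Ls)

    -- The 2k - 1 starting points i of a wrapping square of half-length k: n - 2k < i < n.
    wrapWitnesses : ℕ → List (List ℕ)
    wrapWitnesses k = markedWindows k (applyUpTo (suc n ∸ (k + k) +_) (k + k ∸ 1))

    ∈-wrapWitnesses⁺ : ∀ {k i u} → k + k ≤ n → 1 ≤ k → i < n → n < i + (k + k) →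
      u ∈ sqFree (window i k Ls) → (i ∷ u) ∈ wrapWitnesses k
    ∈-wrapWitnesses⁺ {suc k′} {i} kk≤n _ i<n wraps u∈ =
      ∈-markedWindows⁺ (∈-applyUpTo-+ start≤i (subst (i <_) (sym (m∸n+n≡m (<⇒≤ kk≤n))) i<n)) u∈
      where
      start≤i : suc n ∸ (suc k′ + suc k′) ≤ i
      start≤i = subst (suc n ∸ (suc k′ + suc k′) ≤_) (m+n∸n≡m i (suc k′ + suc k′))
                  (∸-monoˡ-≤ (suc k′ + suc k′) wraps)

    wrapWitnesses-bound : ∀ k → k ≤ n → 3 ^ k * length (wrapWitnesses k) ≤ (k + k ∸ 1) * #sqFree Ls
    wrapWitnesses-bound k k≤n =
      subst (λ m → 3 ^ k * length (wrapWitnesses k) ≤ m * #sqFree Ls)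
        (length-applyUpTo (suc n ∸ (k + k) +_) (k + k ∸ 1))
        (markedWindows-bound k (applyUpTo (suc n ∸ (k + k) +_) (k + k ∸ 1)) k≤n)

    witnesses : ℕ → List (List ℕ)
    witnesses zero    = []
    witnesses (suc K) = wrapWitnesses (suc K) ++ witnesses K

    ∈-witnesses⁺ : ∀ {K k u} → 1 ≤ k → k ≤ K → u ∈ wrapWitnesses k → u ∈ witnesses K
    ∈-witnesses⁺ {zero}  (s≤s _) ()
    ∈-witnesses⁺ {suc K} {k} 1≤k k≤1+K u∈ with m≤n⇒m<n∨m≡n k≤1+K
    ... | inj₂ refl = ∈-++⁺ˡ u∈
    ... | inj₁ k<1+K = ∈-++⁺ʳ (wrapWitnesses (suc K)) (∈-witnesses⁺ 1≤k (≤-pred k<1+K) u∈)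

    -- Σ_{k=1}^{K} (2k - 1) / 3^k = 1 - (K + 1) / 3^K, cleared of denominators.
    witnesses-bound : ∀ K → K ≤ n → 3 ^ K * length (witnesses K) + suc K * #sqFree Ls ≤ 3 ^ K * #sqFree Ls
    witnesses-bound zero    _   = ≤-refl
    witnesses-bound (suc K) K<n = begin
      3 ^ suc K * length (wrapWitnesses (suc K) ++ witnesses K) + suc (suc K) * T
        ≡⟨ cong (λ m → 3 ^ suc K * m + suc (suc K) * T) (length-++ (wrapWitnesses (suc K))) ⟩
      3 * 3 ^ K * (length (wrapWitnesses (suc K)) + length (witnesses K)) + (2 + K) * T
        ≡⟨ expand (3 ^ K) (length (wrapWitnesses (suc K))) (length (witnesses K)) T K ⟩
      3 ^ suc K * length (wrapWitnesses (suc K)) + (3 * (3 ^ K * length (witnesses K)) + (2 + K) * T)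
        ≤⟨ +-monoˡ-≤ _ (wrapWitnesses-bound (suc K) K<n) ⟩
      (K + suc K) * T + (3 * (3 ^ K * length (witnesses K)) + (2 + K) * T)
        ≡⟨ collect (3 ^ K * length (witnesses K)) T K ⟩
      3 * (3 ^ K * length (witnesses K) + suc K * T)
        ≤⟨ *-monoʳ-≤ 3 (witnesses-bound K (<⇒≤ K<n)) ⟩
      3 * (3 ^ K * T)
        ≡⟨ sym (*-assoc 3 (3 ^ K) T) ⟩
      3 ^ suc K * T ∎
      where
      open ≤-Reasoning
      T = #sqFree Ls
      expand : ∀ x w y t K → 3 * x * (w + y) + (2 + K) * t ≡ (3 * x) * w + (3 * (x * y) + (2 + K) * t)
      expand = solve-∀
      collect : ∀ a t K → (K + (1 + K)) * t + (3 * a + (2 + K) * t) ≡ 3 * (a + (1 + K) * t)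
      collect = solve-∀

    witnesses<#sqFree : length (witnesses n) < #sqFree Ls
    witnesses<#sqFree = *-cancelˡ-< (3 ^ n) _ _ (begin-strict
      3 ^ n * length (witnesses n)                       <⟨ m<m+n _ (≤-trans #sqFree>0 (m≤m+n _ (n * #sqFree Ls))) ⟩
      3 ^ n * length (witnesses n) + suc n * #sqFree Ls  ≤⟨ witnesses-bound n ≤-refl ⟩
      3 ^ n * #sqFree Ls                                 ∎)
      where
      open ≤-Reasoning
      #sqFree>0 : 0 < #sqFree Ls
      #sqFree>0 = <-≤-trans (m^n>0 3 (length Ls)) (#sqFree-exponential Ls adm)

    CyclicWitness : List ℕ → List ℕ → Set
    CyclicWitness v u = ∃[ i ] ∃[ k ] i < n × 1 ≤ k × k + k ≤ n × CyclicSquare v i k × u ≡ i ∷ window i k v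

    cyclicallySquareFree-exists : ∃[ w ] Fits w Ls × ¬ HasCyclicSquare w
    cyclicallySquareFree-exists with All.all? hasCyclicSquare? (sqFree Ls)
    ... | no ¬all with w , w∈ , ¬sq ← find (All.¬All⇒Any¬ hasCyclicSquare? _ ¬all) =
      w , proj₁ (∈-sqFree⁻ Ls w∈) , ¬sq
    ... | yes all = ⊥-elim (<⇒≱ witnesses<#sqFree
      (length-≤-injectiveRel CyclicWitness (sqFree Ls) (witnesses n) (sqFree-unique Ls adm) witness witness-injective))
      where
      |w|≡n : ∀ {w} → Fits w Ls → length w ≡ n
      |w|≡n fw = trans (Pointwise-length fw) |Ls|≡n
      witness : ∀ {v} → v ∈ sqFree Ls → ∃[ u ] u ∈ witnesses n × CyclicWitness v u
      witness {v} v∈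
        with fv , sf ← ∈-sqFree⁻ Ls v∈
        with i , k , i<n , 1≤k , kk≤n , sq ← All.lookup all v∈ =
        i ∷ window i k v ,
        ∈-witnesses⁺ 1≤k (≤-trans (m≤m+n k k) kk≤n)
          (∈-wrapWitnesses⁺ kk≤n 1≤k i<n (cyclicSquare-wraps (|w|≡n fv) sf 1≤k sq)
            (∈-sqFree⁺ (fits-window i k fv) (squareFree-window i k sf))) ,
        i , k , i<n , 1≤k , kk≤n , sq , refl
      witness-injective : ∀ {a a′ u} → a ∈ sqFree Ls → a′ ∈ sqFree Ls →
        CyclicWitness a u → CyclicWitness a′ u → a ≡ a′
      witness-injective a∈ a′∈ (i , k , i<n , 1≤k , kk≤n , sq , refl)
                                (i′ , k′ , _ , _ , k′k′≤n , sq′ , eq)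
        with refl , windows ← ∷-injective eq
        with fa , sfa ← ∈-sqFree⁻ Ls a∈ =
        window-determines (|w|≡n fa) (|w|≡n (proj₁ (∈-sqFree⁻ Ls a′∈))) sq sq′ kk≤n k′k′≤n i<n
          (cyclicSquare-wraps (|w|≡n fa) sfa 1≤k sq) windows

toℕ-cyc : ∀ {m} (i : Fin (suc m)) j → toℕ (cyc i j) ≡ (toℕ i + j) % suc m
toℕ-cyc {m} i j = toℕ-fromℕ< (m%n<n (toℕ i + j) (suc m))

module Facial (n′ : ℕ) (w : List ℕ) where

  private
    n = suc n′
  open Cyclic n

  colour : Fin n → ℕ
  colour v = at w (toℕ v)

  colour-cyc : ∀ i m → colour (cyc i m) ≡ at w ((toℕ i + m) % n)
  colour-cyc i m = cong (at w) (toℕ-cyc i m)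

  forward-repetition⇒cyclicSquare : ∀ i k → IsRepetition k (λ j → colour (cyc i (j * 1))) →
    CyclicSquare w (toℕ i) k
  forward-repetition⇒cyclicSquare i k rep {j} j<k =
    trans (sym (colour-cyc′ j)) (trans (rep j j<k) (colour-cyc′ (k + j)))
    where
    colour-cyc′ : ∀ m → colour (cyc i (m * 1)) ≡ at w ((toℕ i + m) % n)
    colour-cyc′ m = trans (colour-cyc i (m * 1)) (cong (λ x → at w ((toℕ i + x) % n)) (*-identityʳ m))

  -- Stepping by n′ ≡ -1: a repetition read backwards from i is a square starting 2k - 1 steps before i.
  backward-repetition⇒cyclicSquare : ∀ i k → IsRepetition (suc k) (λ j → colour (cyc i (j * n′))) →
    CyclicSquare w (toℕ i + (suc k + k) * n′) (suc k)
  backward-repetition⇒cyclicSquare i k rep {t} t<1+k with j , refl ← m≤n⇒∃[o]m+o≡n (≤-pred t<1+k) = begin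
    at w ((toℕ i + (suc (t + j) + (t + j)) * n′ + t) % n)
      ≡⟨ cong (at w) first-half ⟩
    at w ((toℕ i + (suc (t + j) + j) * n′) % n)
      ≡⟨ sym (colour-cyc i ((suc (t + j) + j) * n′)) ⟩
    colour (cyc i ((suc (t + j) + j) * n′))
      ≡⟨ sym (rep j (s≤s (m≤n+m j t))) ⟩
    colour (cyc i (j * n′))
      ≡⟨ colour-cyc i (j * n′) ⟩
    at w ((toℕ i + j * n′) % n)
      ≡⟨ cong (at w) (sym second-half) ⟩
    at w ((toℕ i + (suc (t + j) + (t + j)) * n′ + (suc (t + j) + t)) % n) ∎
    where
    open ≡-Reasoning
    shift₁ : ∀ i t j n′ → i + (suc (t + j) + (t + j)) * n′ + t ≡ i + (suc (t + j) + j) * n′ + t * suc n′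
    shift₁ = solve-∀
    shift₂ : ∀ i t j n′ →
      i + (suc (t + j) + (t + j)) * n′ + (suc (t + j) + t) ≡ i + j * n′ + (suc (t + j) + t) * suc n′
    shift₂ = solve-∀
    first-half : (toℕ i + (suc (t + j) + (t + j)) * n′ + t) % n ≡ (toℕ i + (suc (t + j) + j) * n′) % n
    first-half = trans (cong (_% n) (shift₁ (toℕ i) t j n′))
                       ([m+kn]%n≡m%n (toℕ i + (suc (t + j) + j) * n′) t n)
    second-half : (toℕ i + (suc (t + j) + (t + j)) * n′ + (suc (t + j) + t)) % n ≡ (toℕ i + j * n′) % n
    second-half = trans (cong (_% n) (shift₂ (toℕ i) t j n′))
                        ([m+kn]%n≡m%n (toℕ i + j * n′) (suc (t + j) + t) n)

  2k≤n⇒k+k≤n : ∀ {k} → 2 * k ≤ n → k + k ≤ n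
  2k≤n⇒k+k≤n {k} = subst (_≤ n) (cong (k +_) (+-identityʳ k))

  noCyclicSquare⇒facialNonRepetitive : ¬ HasCyclicSquare w → FacialNonRepetitive n colour
  noCyclicSquare⇒facialNonRepetitive ¬sq i s (inj₁ refl) k 1≤k 2k≤n rep =
    ¬sq (toℕ i , k , toℕ<n i , 1≤k , 2k≤n⇒k+k≤n {k} 2k≤n , forward-repetition⇒cyclicSquare i k rep)
  noCyclicSquare⇒facialNonRepetitive ¬sq i s (inj₂ refl) (suc k) 1≤k 2k≤n rep =
    ¬sq (start % n , suc k , m%n<n start n , 1≤k , 2k≤n⇒k+k≤n {suc k} 2k≤n ,
         cyclicSquare-% {w} {start} (backward-repetition⇒cyclicSquare i k rep))
    where
    start = toℕ i + (suc k + k) * n′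

fits-tabulate : ∀ {m} (g : Fin m → List ℕ) {w} → Fits w (tabulate g) → ∀ v → at w (toℕ v) ∈ g v
fits-tabulate g (x∈ ∷ _)  Fin.zero    = x∈
fits-tabulate g (_  ∷ fw) (Fin.suc v) = fits-tabulate (g ∘ Fin.suc) fw v

module Assignment {n} (L : Fin n → ℕ → Set) (assignment : ListAssignment n 5 L) where

  choice : Fin n → Fin 5 → ℕ
  choice v = proj₁ (proj₂ (assignment v))

  lists : List (List ℕ)
  lists = tabulate (tabulate ∘ choice)

  length-lists : length lists ≡ n
  length-lists = length-tabulate (tabulate ∘ choice)

  lists-admissible : Admissible lists
  lists-admissible = All.tabulate⁺ λ v →
    Unique.tabulate⁺ (proj₁ (proj₂ (proj₂ (assignment v)))) , ≤-reflexive (sym (length-tabulate (choice v)))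

  fits⇒∈L : ∀ {w} → Fits w lists → ∀ v → L v (at w (toℕ v))
  fits⇒∈L fw v with a , eq ← ∈-tabulate⁻ (fits-tabulate (tabulate ∘ choice) fw v) =
    subst (L v) (sym eq) (proj₂ (proj₂ (proj₂ (assignment v))) a)

theorem5 : (n : ℕ) → 3 ≤ n → PiFLAtMost n 5
theorem5 zero ()
theorem5 (suc n′) _ L assignment =
  let open Assignment L assignment
      w , w-fits , w-noSquare = Cyclic.cyclicallySquareFree-exists (suc n′) lists length-lists lists-admissible
      open Facial n′ w
  in colour , fits⇒∈L w-fits , noCyclicSquare⇒facialNonRepetitive w-noSquare
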